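{- Let $\mathscr A$ be a totally ordered set and $B$ a finite set. Two words $w,w'$ with letters in $\mathscr A\times B$ have the same insertion tableau $\mathbf P$ under the Robinson–Schensted–Okada correspondence if and only if there exists a sequence of words $w=w_1\sim_K w_2\sim_K\cdots\sim_K w_k=w'$.
   Context: For a word $w=x_1\cdots x_n$ with letters $x_i=(a_i,b_i)\in\mathscr A\times B$ and $b\in B$, let $w^{(b)}=a_{j_1}a_{j_2}\cdots a_{j_r}$ where $j_1<\dots<j_r$ are the indices $j$ with $b_j=b$. The RSO insertion tableau of $w$ is the family $\mathbf P=(P_b)_{b\in B}$ where $P_b$ is the Robinson–Schensted (row bumping) insertion tableau of the word $w^{(b)}$. Knuth relations on words over $\mathscr A\times B$: $w=x_1\cdots x_n$ and $w'=x'_1\cdots x'_n$ (with $x_i=(a_i,b_i)$, $x'_i=(a'_i,b'_i)$) satisfy $w\sim_Kw'$ if there is an index $i$ such that either (c) $b_i\neq b_{i+1}$, $x_i=x'_{i+1}$, $x_{i+1}=x'_i$ and $x_j=x'_j$ for $j\notin\{i,i+1\}$; or (d) $b_i=b_{i+1}=b_{i+2}=b'_i=b'_{i+1}=b'_{i+2}$, $x_j=x'_j$ for $j\notin\{i,i+1,i+2\}$, and the words $u=a_ia_{i+1}a_{i+2}$, $u'=a'_ia'_{i+1}a'_{i+2}$ satisfy $\{u,u'\}=\{acb,cab\}$ for some letters $a\leq b<c$ of $\mathscr A$, or $\{u,u'\}=\{bac,bca\}$ for some letters $a<b\leq c$ of $\mathscr A$. -}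

module Defs where

open import Data.Nat using (ℕ)
open import Data.Fin using (Fin)
import Data.Fin.Properties as FinP
open import Data.List using (List; []; _∷_; _++_; foldl)
open import Data.Maybe using (Maybe; just; nothing)
open import Data.Product using (_×_; _,_; proj₁; proj₂)
open import Data.Sum using (_⊎_)
open import Function.Bundles using (_↔_; Inverse)
open import Relation.Nullary using (¬_; yes; no)
open import Relation.Binary.Core using (Rel)
open import Level using (0ℓ)
open import Relation.Binary.Structures using (IsStrictTotalOrder)
open import Relation.Binary.PropositionalEquality using (_≡_)
open import Relation.Binary.Construct.Closure.ReflexiveTransitive using (Star)

-- A totally ordered set 𝒜 is given by a carrier A with a strict total order _<_
-- (with respect to propositional equality); a ≤ b means a < b or a ≡ b.
module RSO (A : Set) (_<_ : Rel A 0ℓ) (sto : IsStrictTotalOrder _≡_ _<_)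
           (B : Set) (n : ℕ) (fin : B ↔ Fin n) where

  open IsStrictTotalOrder sto using (_<?_)

  _≤_ : A → A → Set
  a ≤ b = (a < b) ⊎ (a ≡ b)

  Letter : Set
  Letter = A × B

  Word : Set
  Word = List Letter

  restrict : B → Word → List A
  restrict b [] = []
  restrict b ((a , c) ∷ w) with FinP._≟_ (Inverse.to fin c) (Inverse.to fin b)
  ... | yes _ = a ∷ restrict b w
  ... | no  _ = restrict b w

  -- Tableaux as lists of rows (top row first)
  Tableau : Set
  Tableau = List (List A)

  insertRow : A → List A → Maybe A × List A
  insertRow x [] = nothing , x ∷ []
  insertRow x (y ∷ ys) with x <? y
  ... | yes _ = just y , x ∷ ys
  ... | no  _ = proj₁ (insertRow x ys) , y ∷ proj₂ (insertRow x ys)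

  insert : A → Tableau → Tableau
  insert x [] = (x ∷ []) ∷ []
  insert x (r ∷ rs) with insertRow x r
  ... | nothing , r' = r' ∷ rs
  ... | just y  , r' = r' ∷ insert y rs

  RS : List A → Tableau
  RS = foldl (λ T x → insert x T) []

  -- RSO insertion tableau: the family (P_b)_{b ∈ B}
  RSO-P : Word → B → Tableau
  RSO-P w b = RS (restrict b (w))

  data KnuthStep : Word → Word → Set where
    swapC : ∀ (u v : Word) (x y : Letter) → ¬ (proj₂ x ≡ proj₂ y) →
            KnuthStep (u ++ x ∷ y ∷ v) (u ++ y ∷ x ∷ v)
    acb→cab : ∀ (u v : Word) (β : B) (a b c : A) → a ≤ b → b < c →
            KnuthStep (u ++ (a , β) ∷ (c , β) ∷ (b , β) ∷ v)
                      (u ++ (c , β) ∷ (a , β) ∷ (b , β) ∷ v)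
    cab→acb : ∀ (u v : Word) (β : B) (a b c : A) → a ≤ b → b < c →
            KnuthStep (u ++ (c , β) ∷ (a , β) ∷ (b , β) ∷ v)
                      (u ++ (a , β) ∷ (c , β) ∷ (b , β) ∷ v)
    bac→bca : ∀ (u v : Word) (β : B) (a b c : A) → a < b → b ≤ c →
            KnuthStep (u ++ (b , β) ∷ (a , β) ∷ (c , β) ∷ v)
                      (u ++ (b , β) ∷ (c , β) ∷ (a , β) ∷ v)
    bca→bac : ∀ (u v : Word) (β : B) (a b c : A) → a < b → b ≤ c →
            KnuthStep (u ++ (b , β) ∷ (c , β) ∷ (a , β) ∷ v)
                      (u ++ (b , β) ∷ (a , β) ∷ (c , β) ∷ v)

  KnuthEquiv : Word → Word → Set
  KnuthEquiv = Star KnuthStep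

module Submission where

-- A move of type (c) leaves every w^(b) unchanged, and such moves separate the colour classes:
-- w is Knuth equivalent to the concatenation of its one-coloured blocks w^(b), taken in any fixed
-- order of the colours. A move of type (d) changes a single w^(b) by an elementary Knuth move. So
-- everything reduces to Knuth's theorem for one colour. Its first half is the row lemma: inserting
-- the two sides of an elementary Knuth move into a sorted row gives the same row and bumped-out
-- words that are equal or again related by an elementary Knuth move, so by induction over the rows
-- the tableaux agree. Its second half: appending a letter to the reading word of a tableau is
-- Knuth equivalent to inserting it, one row at a time, so every word is Knuth equivalent to the
-- reading word of its insertion tableau.

open import Defs
open import Data.Nat using (ℕ)
open import Data.Fin using (Fin)
import Data.Fin.Properties as FinP
open import Data.List using (List; []; _∷_; _++_; foldl; map; fromMaybe; allFin)
open import Data.List.Properties using (foldl-++; map-++; ++-assoc; ++-identityʳ)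
open import Data.List.Relation.Unary.All as All using (All; []; _∷_)
open import Data.List.Relation.Unary.AllPairs using (AllPairs; []; _∷_)
open import Data.List.Relation.Unary.Any using (here; there)
open import Data.List.Membership.Propositional using (_∈_)
open import Data.List.Membership.Propositional.Properties using (∈-map⁺; ∈-allFin)
open import Data.Maybe using (Maybe; just; nothing)
import Data.Maybe.Relation.Unary.All as Maybe
open import Data.Product using (_×_; _,_; proj₁; proj₂; ∃)
open import Data.Sum using (inj₁; inj₂)
open import Data.Empty using (⊥; ⊥-elim)
open import Function.Bundles using (_↔_; Inverse; Injection)
open import Function.Properties.Inverse using (↔⇒↣)
open import Level using (0ℓ)
open import Relation.Binary using (tri<; tri≈; tri>)
open import Relation.Binary.Core using (Rel)
open import Relation.Binary.Structures using (IsStrictTotalOrder)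
open import Relation.Binary.PropositionalEquality
  using (_≡_; refl; sym; trans; cong; cong₂; subst; module ≡-Reasoning)
open import Relation.Binary.Construct.Closure.Reflexive as Refl using (ReflClosure; [_])
import Relation.Binary.Construct.Closure.Reflexive.Properties as ReflProps
open import Relation.Binary.Construct.Closure.ReflexiveTransitive using (ε; _◅_; _◅◅_; gmap; reverse)
open import Relation.Nullary using (¬_; yes; no; Dec)

module RSOKnuth (A : Set) (_<_ : Rel A 0ℓ) (sto : IsStrictTotalOrder _≡_ _<_)
             (B : Set) (n : ℕ) (fin : B ↔ Fin n) where

  open RSO A _<_ sto B n fin
  open IsStrictTotalOrder sto
    using (compare; _<?_; asym; irrefl; isEquivalence; <-resp-≈; <-respˡ-≈; <-respʳ-≈)
    renaming (trans to <-trans)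
  import Relation.Binary.Construct.StrictToNonStrict {A = A} _≡_ _<_ as NonStrict

  ≤-<-trans : ∀ {a b c} → a ≤ b → b < c → a < c
  ≤-<-trans = NonStrict.≤-<-trans sym <-trans <-respˡ-≈

  <-≤-trans : ∀ {a b c} → a < b → b ≤ c → a < c
  <-≤-trans = NonStrict.<-≤-trans <-trans <-respʳ-≈

  ≤-trans : ∀ {a b c} → a ≤ b → b ≤ c → a ≤ c
  ≤-trans = NonStrict.trans isEquivalence <-resp-≈ <-trans

  ≤-refl : ∀ {a} → a ≤ a
  ≤-refl = inj₂ refl

  ≮⇒≥ : ∀ {a b} → ¬ a < b → b ≤ a
  ≮⇒≥ {a} {b} a≮b with compare a b
  ... | tri< a<b _ _ = ⊥-elim (a≮b a<b)
  ... | tri≈ _ a≡b _ = inj₂ (sym a≡b)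
  ... | tri> _ _ b<a = inj₁ b<a

  ≤⇒≯ : ∀ {a b} → a ≤ b → ¬ b < a
  ≤⇒≯ (inj₁ a<b) = asym a<b
  ≤⇒≯ (inj₂ refl) = irrefl refl

  -- Row insertion

  Sorted : List A → Set
  Sorted = AllPairs _≤_

  bumped : A → List A → Maybe A
  bumped x r = proj₁ (insertRow x r)

  newRow : A → List A → List A
  newRow x r = proj₂ (insertRow x r)

  insertRow-< : ∀ {x y} ys → x < y → insertRow x (y ∷ ys) ≡ (just y , x ∷ ys)
  insertRow-< {x} {y} ys x<y with x <? y
  ... | yes _ = refl
  ... | no x≮y = ⊥-elim (x≮y x<y)

  insertRow-≮ : ∀ {x y} ys → ¬ x < y → insertRow x (y ∷ ys) ≡ (bumped x ys , y ∷ newRow x ys)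
  insertRow-≮ {x} {y} ys x≮y with x <? y
  ... | yes x<y = ⊥-elim (x≮y x<y)
  ... | no _ = refl

  newRow-All : ∀ (P : A → Set) {x} r → All P r → P x → All P (newRow x r)
  newRow-All P [] _ px = px ∷ []
  newRow-All P {x} (y ∷ r) (py ∷ pr) px with x <? y
  ... | yes _ = px ∷ pr
  ... | no _ = py ∷ newRow-All P r pr px

  bumped-All : ∀ (P : A → Set) x r → All P r → Maybe.All P (bumped x r)
  bumped-All P x [] _ = Maybe.nothing
  bumped-All P x (y ∷ r) (py ∷ pr) with x <? y
  ... | yes _ = Maybe.just py
  ... | no _ = bumped-All P x r pr

  bumped-> : ∀ x r → Maybe.All (x <_) (bumped x r)
  bumped-> x [] = Maybe.nothing
  bumped-> x (y ∷ r) with x <? y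
  ... | yes x<y = Maybe.just x<y
  ... | no _ = bumped-> x r

  newRow-sorted : ∀ x r → Sorted r → Sorted (newRow x r)
  newRow-sorted x [] _ = [] ∷ []
  newRow-sorted x (y ∷ r) (y≤r ∷ sr) with x <? y
  ... | yes x<y = All.map (λ y≤z → inj₁ (<-≤-trans x<y y≤z)) y≤r ∷ sr
  ... | no x≮y = newRow-All (y ≤_) r y≤r (≮⇒≥ x≮y) ∷ newRow-sorted x r sr

  ∈-newRow : ∀ x r → x ∈ newRow x r
  ∈-newRow x [] = here refl
  ∈-newRow x (y ∷ r) with x <? y
  ... | yes _ = here refl
  ... | no _ = there (∈-newRow x r)

  bumped-≤ : ∀ {x z} r → Sorted r → z ∈ r → x < z → ∃ λ o → bumped x r ≡ just o × o ≤ z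
  bumped-≤ {x} (y ∷ r) (y≤r ∷ sr) z∈ x<z with x <? y | z∈
  ... | yes _ | here refl = y , refl , ≤-refl
  ... | yes _ | there z∈r = y , refl , All.lookup y≤r z∈r
  ... | no x≮y | here refl = ⊥-elim (x≮y x<z)
  ... | no _ | there z∈r = bumped-≤ r sr z∈r x<z

  data BumpsInOrder : Maybe A → Maybe A → Set where
    neither : BumpsInOrder nothing nothing
    first   : ∀ {o} → BumpsInOrder (just o) nothing
    both    : ∀ {o o'} → o ≤ o' → BumpsInOrder (just o) (just o')

  bumps-in-order : ∀ y z r → Sorted r → y ≤ z → BumpsInOrder (bumped y r) (bumped z (newRow y r))
  bumps-in-order y z [] _ y≤z with z <? y
  ... | yes z<y = ⊥-elim (≤⇒≯ y≤z z<y)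
  ... | no _ = neither
  bumps-in-order y z (h ∷ t) (h≤t ∷ st) y≤z with y <? h
  ... | yes _ with z <? y
  ...   | yes z<y = ⊥-elim (≤⇒≯ y≤z z<y)
  ...   | no _ = after-h (bumped-All (h ≤_) z t h≤t)
    where
    after-h : ∀ {m} → Maybe.All (h ≤_) m → BumpsInOrder (just h) m
    after-h Maybe.nothing = first
    after-h (Maybe.just h≤o) = both h≤o
  bumps-in-order y z (h ∷ t) (h≤t ∷ st) y≤z | no y≮h with z <? h
  ...   | yes z<h = ⊥-elim (≤⇒≯ (≤-trans (≮⇒≥ y≮h) y≤z) z<h)
  ...   | no _ = bumps-in-order y z t st y≤z

  insertRowAll : List A → List A → List A × List A
  insertRowAll r [] = r , []
  insertRowAll r (x ∷ s) =
    proj₁ (insertRowAll (newRow x r) s) , fromMaybe (bumped x r) ++ proj₂ (insertRowAll (newRow x r) s)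

  insertRowAll-skip : ∀ h r s → All (λ x → ¬ x < h) s →
                      insertRowAll (h ∷ r) s ≡ (h ∷ proj₁ (insertRowAll r s) , proj₂ (insertRowAll r s))
  insertRowAll-skip h r [] _ = refl
  insertRowAll-skip h r (x ∷ s) (x≮h ∷ s≮h)
    rewrite insertRow-≮ r x≮h | insertRowAll-skip h (newRow x r) s s≮h = refl

  -- Knuth moves inside a row and a tableau

  data KnuthTriple : List A → List A → Set where
    acb→cab : ∀ {a b c} → a ≤ b → b < c → KnuthTriple (a ∷ c ∷ b ∷ []) (c ∷ a ∷ b ∷ [])
    cab→acb : ∀ {a b c} → a ≤ b → b < c → KnuthTriple (c ∷ a ∷ b ∷ []) (a ∷ c ∷ b ∷ [])
    bac→bca : ∀ {a b c} → a < b → b ≤ c → KnuthTriple (b ∷ a ∷ c ∷ []) (b ∷ c ∷ a ∷ [])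
    bca→bac : ∀ {a b c} → a < b → b ≤ c → KnuthTriple (b ∷ c ∷ a ∷ []) (b ∷ a ∷ c ∷ [])

  KnuthTriple-sym : ∀ {s s'} → KnuthTriple s s' → KnuthTriple s' s
  KnuthTriple-sym (acb→cab p q) = cab→acb p q
  KnuthTriple-sym (cab→acb p q) = acb→cab p q
  KnuthTriple-sym (bac→bca p q) = bca→bac p q
  KnuthTriple-sym (bca→bac p q) = bac→bca p q

  RowInsertionsAgree : List A → List A → List A → Set
  RowInsertionsAgree r s s' =
    proj₁ (insertRowAll r s) ≡ proj₁ (insertRowAll r s') ×
    ReflClosure KnuthTriple (proj₂ (insertRowAll r s)) (proj₂ (insertRowAll r s'))

  RowInsertionsAgree-sym : ∀ r s s' → RowInsertionsAgree r s s' → RowInsertionsAgree r s' s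
  RowInsertionsAgree-sym r s s' (same , related) = sym same , ReflProps.sym KnuthTriple-sym related

  RowInsertionsAgree-skip : ∀ h r s s' → All (λ x → ¬ x < h) s → All (λ x → ¬ x < h) s' →
                            RowInsertionsAgree r s s' → RowInsertionsAgree (h ∷ r) s s'
  RowInsertionsAgree-skip h r s s' s≮h s'≮h (same , related)
    rewrite insertRowAll-skip h r s s≮h | insertRowAll-skip h r s' s'≮h = cong (h ∷_) same , related

  insertRowAll-[]-triple : ∀ {s s'} → KnuthTriple s s' → insertRowAll [] s ≡ insertRowAll [] s'
  insertRowAll-[]-triple (acb→cab {a} {b} {c} a≤b b<c)
    rewrite insertRow-≮ [] (≤⇒≯ (inj₁ (≤-<-trans a≤b b<c)))
          | insertRow-< [] (≤-<-trans a≤b b<c)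
          | insertRow-≮ (c ∷ []) (≤⇒≯ a≤b)
          | insertRow-≮ [] (≤⇒≯ a≤b)
          | insertRow-< [] b<c = refl
  insertRowAll-[]-triple (cab→acb a≤b b<c) = sym (insertRowAll-[]-triple (acb→cab a≤b b<c))
  insertRowAll-[]-triple (bac→bca {a} {b} {c} a<b b≤c)
    rewrite insertRow-< [] a<b
          | insertRow-≮ [] (≤⇒≯ (inj₁ (<-≤-trans a<b b≤c)))
          | insertRow-≮ [] (≤⇒≯ b≤c)
          | insertRow-< (c ∷ []) a<b = refl
  insertRowAll-[]-triple (bca→bac a<b b≤c) = sym (insertRowAll-[]-triple (bac→bca a<b b≤c))

  RowInsertionsAgree-[] : ∀ {s s'} → KnuthTriple s s' → RowInsertionsAgree [] s s'
  RowInsertionsAgree-[] k = cong proj₁ same , Refl.reflexive (cong proj₂ same)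
    where same = insertRowAll-[]-triple k

  acb-cab-row-a<h≤c : ∀ {a b c h} t → All (h ≤_) t → Sorted t →
                      a ≤ b → b < c → a < h → ¬ c < h →
                      RowInsertionsAgree (h ∷ t) (a ∷ c ∷ b ∷ []) (c ∷ a ∷ b ∷ [])
  acb-cab-row-a<h≤c {a} {b} {c} {h} t h≤t st a≤b b<c a<h c≮h
    rewrite insertRow-< t a<h | insertRow-≮ t c≮h | insertRow-< (newRow c t) a<h
          | insertRow-≮ t (≤⇒≯ (inj₁ (≤-<-trans a≤b b<c)))
          | insertRow-≮ (newRow c t) (≤⇒≯ a≤b)
    = refl , bumpedWords (bumped c t) (bumped b (newRow c t)) (bumped-> c t)
               (bumped-All (h ≤_) b _ (newRow-All (h ≤_) t h≤t (≮⇒≥ c≮h)))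
               (bumped-≤ (newRow c t) (newRow-sorted c t st) (∈-newRow c t) b<c)
    where
    bumpedWords : ∀ (mc mb : Maybe A) → Maybe.All (c <_) mc → Maybe.All (h ≤_) mb →
                  ∃ (λ o → mb ≡ just o × o ≤ c) →
                  ReflClosure KnuthTriple (h ∷ (fromMaybe mc ++ (fromMaybe mb ++ [])))
                                          (fromMaybe mc ++ (h ∷ (fromMaybe mb ++ [])))
    bumpedWords nothing _ _ _ _ = Refl.refl
    bumpedWords (just oc) _ (Maybe.just c<oc) (Maybe.just h≤o) (o , refl , o≤c) =
      [ acb→cab h≤o (≤-<-trans o≤c c<oc) ]

  acb-cab-row-a,c<h : ∀ {a b c h} t → All (h ≤_) t → a ≤ b → b < c → a < h → c < h →
                      RowInsertionsAgree (h ∷ t) (a ∷ c ∷ b ∷ []) (c ∷ a ∷ b ∷ [])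
  acb-cab-row-a,c<h {a} {b} {c} [] _ a≤b b<c a<h c<h
    rewrite insertRow-< [] a<h | insertRow-≮ [] (≤⇒≯ (inj₁ (≤-<-trans a≤b b<c)))
          | insertRow-< [] c<h | insertRow-< [] (≤-<-trans a≤b b<c)
          | insertRow-≮ (c ∷ []) (≤⇒≯ a≤b) | insertRow-≮ [] (≤⇒≯ a≤b)
          | insertRow-< [] b<c
    = refl , Refl.refl
  acb-cab-row-a,c<h {a} {b} {c} (t₀ ∷ ts) (h≤t₀ ∷ _) a≤b b<c a<h c<h
    rewrite insertRow-< (t₀ ∷ ts) a<h | insertRow-< (t₀ ∷ ts) c<h
          | insertRow-≮ (t₀ ∷ ts) (≤⇒≯ (inj₁ (≤-<-trans a≤b b<c)))
          | insertRow-< ts (<-≤-trans c<h h≤t₀)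
          | insertRow-< (t₀ ∷ ts) (≤-<-trans a≤b b<c)
          | insertRow-≮ (c ∷ ts) (≤⇒≯ a≤b) | insertRow-≮ (t₀ ∷ ts) (≤⇒≯ a≤b)
          | insertRow-< ts b<c | insertRow-< ts (<-trans b<c (<-≤-trans c<h h≤t₀))
    = refl , [ bca→bac c<h h≤t₀ ]

  acb-cab-row : ∀ {a b c} r → Sorted r → a ≤ b → b < c →
                RowInsertionsAgree r (a ∷ c ∷ b ∷ []) (c ∷ a ∷ b ∷ [])
  acb-cab-row [] _ a≤b b<c = RowInsertionsAgree-[] (acb→cab a≤b b<c)
  acb-cab-row {a} {b} {c} (h ∷ t) (h≤t ∷ st) a≤b b<c = cases (a <? h) (c <? h)
    where
    cases : Dec (a < h) → Dec (c < h) → RowInsertionsAgree (h ∷ t) (a ∷ c ∷ b ∷ []) (c ∷ a ∷ b ∷ [])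
    cases (no a≮h) _ =
      RowInsertionsAgree-skip h t _ _ (a≮h ∷ c≮h ∷ b≮h ∷ []) (c≮h ∷ a≮h ∷ b≮h ∷ [])
        (acb-cab-row t st a≤b b<c)
      where
      b≮h : ¬ b < h
      b≮h b<h = a≮h (≤-<-trans a≤b b<h)
      c≮h : ¬ c < h
      c≮h c<h = a≮h (≤-<-trans a≤b (<-trans b<c c<h))
    cases (yes a<h) (no c≮h) = acb-cab-row-a<h≤c t h≤t st a≤b b<c a<h c≮h
    cases (yes a<h) (yes c<h) = acb-cab-row-a,c<h t h≤t a≤b b<c a<h c<h

  bac-bca-row-a<h≤b : ∀ {a b c h} t → Sorted t → a < b → b ≤ c → a < h → ¬ b < h →
                      RowInsertionsAgree (h ∷ t) (b ∷ a ∷ c ∷ []) (b ∷ c ∷ a ∷ [])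
  bac-bca-row-a<h≤b {a} {b} {c} {h} t st a<b b≤c a<h b≮h
    rewrite insertRow-≮ t b≮h | insertRow-< (newRow b t) a<h
          | insertRow-≮ (newRow b t) (≤⇒≯ (inj₁ (<-≤-trans a<b b≤c)))
          | insertRow-≮ (newRow b t) (λ c<h → b≮h (≤-<-trans b≤c c<h))
          | insertRow-< (newRow c (newRow b t)) a<h
    = refl , bumpedWords (bumped b t) (bumped c (newRow b t)) (h<bumped (bumped-> b t))
               (bumps-in-order b c t st b≤c)
    where
    h<bumped : ∀ {m} → Maybe.All (b <_) m → Maybe.All (h <_) m
    h<bumped = Maybe.map (≤-<-trans (≮⇒≥ b≮h))
    bumpedWords : ∀ (mb mc : Maybe A) → Maybe.All (h <_) mb → BumpsInOrder mb mc →
                  ReflClosure KnuthTriple (fromMaybe mb ++ (h ∷ (fromMaybe mc ++ [])))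
                                          (fromMaybe mb ++ (fromMaybe mc ++ (h ∷ [])))
    bumpedWords _ _ _ neither = Refl.refl
    bumpedWords _ _ _ first = Refl.refl
    bumpedWords _ _ (Maybe.just h<ob) (both ob≤oc) = [ bac→bca h<ob ob≤oc ]

  bac-bca-row-a,b<h : ∀ {a b c h} t → All (h ≤_) t → a < b → b ≤ c → b < h →
                      RowInsertionsAgree (h ∷ t) (b ∷ a ∷ c ∷ []) (b ∷ c ∷ a ∷ [])
  bac-bca-row-a,b<h {a} {b} {c} {h} t h≤t a<b b≤c b<h
    rewrite insertRow-< t b<h | insertRow-< t a<b
          | insertRow-≮ t (≤⇒≯ (inj₁ (<-≤-trans a<b b≤c)))
          | insertRow-≮ t (≤⇒≯ b≤c)
          | insertRow-< (newRow c t) a<b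
    = refl , bumpedWords (bumped c t) (bumped-All (h ≤_) c t h≤t)
    where
    bumpedWords : ∀ (mc : Maybe A) → Maybe.All (h ≤_) mc →
                  ReflClosure KnuthTriple (h ∷ b ∷ (fromMaybe mc ++ [])) (h ∷ (fromMaybe mc ++ (b ∷ [])))
    bumpedWords _ Maybe.nothing = Refl.refl
    bumpedWords _ (Maybe.just h≤oc) = [ bac→bca b<h h≤oc ]

  bac-bca-row : ∀ {a b c} r → Sorted r → a < b → b ≤ c →
                RowInsertionsAgree r (b ∷ a ∷ c ∷ []) (b ∷ c ∷ a ∷ [])
  bac-bca-row [] _ a<b b≤c = RowInsertionsAgree-[] (bac→bca a<b b≤c)
  bac-bca-row {a} {b} {c} (h ∷ t) (h≤t ∷ st) a<b b≤c = cases (a <? h) (b <? h)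
    where
    cases : Dec (a < h) → Dec (b < h) → RowInsertionsAgree (h ∷ t) (b ∷ a ∷ c ∷ []) (b ∷ c ∷ a ∷ [])
    cases (no a≮h) _ =
      RowInsertionsAgree-skip h t _ _ (b≮h ∷ a≮h ∷ c≮h ∷ []) (b≮h ∷ c≮h ∷ a≮h ∷ [])
        (bac-bca-row t st a<b b≤c)
      where
      b≮h : ¬ b < h
      b≮h b<h = a≮h (<-trans a<b b<h)
      c≮h : ¬ c < h
      c≮h c<h = a≮h (<-trans (<-≤-trans a<b b≤c) c<h)
    cases (yes a<h) (no b≮h) = bac-bca-row-a<h≤b t st a<b b≤c a<h b≮h
    cases (yes _) (yes b<h) = bac-bca-row-a,b<h t h≤t a<b b≤c b<h

  knuthTriple-row : ∀ {s s'} r → Sorted r → KnuthTriple s s' → RowInsertionsAgree r s s'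
  knuthTriple-row r sr (acb→cab p q) = acb-cab-row r sr p q
  knuthTriple-row r sr (cab→acb {a} {b} {c} p q) =
    RowInsertionsAgree-sym r (a ∷ c ∷ b ∷ []) (c ∷ a ∷ b ∷ []) (acb-cab-row r sr p q)
  knuthTriple-row r sr (bac→bca p q) = bac-bca-row r sr p q
  knuthTriple-row r sr (bca→bac {a} {b} {c} p q) =
    RowInsertionsAgree-sym r (b ∷ a ∷ c ∷ []) (b ∷ c ∷ a ∷ []) (bac-bca-row r sr p q)

  insertAll : Tableau → List A → Tableau
  insertAll T s = foldl (λ T x → insert x T) T s

  insertAll-++ : ∀ T s s' → insertAll T (s ++ s') ≡ insertAll (insertAll T s) s'
  insertAll-++ T s s' = foldl-++ (λ T x → insert x T) T s s'

  insert-∷ : ∀ x r rs → insert x (r ∷ rs) ≡ newRow x r ∷ insertAll rs (fromMaybe (bumped x r))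
  insert-∷ x r rs with insertRow x r
  ... | nothing , _ = refl
  ... | just _ , _ = refl

  insertAll-∷ : ∀ r rs s →
    insertAll (r ∷ rs) s ≡ proj₁ (insertRowAll r s) ∷ insertAll rs (proj₂ (insertRowAll r s))
  insertAll-∷ r rs [] = refl
  insertAll-∷ r rs (x ∷ s) =
    begin
      insertAll (insert x (r ∷ rs)) s
    ≡⟨ cong (λ T → insertAll T s) (insert-∷ x r rs) ⟩
      insertAll (newRow x r ∷ insertAll rs (fromMaybe (bumped x r))) s
    ≡⟨ insertAll-∷ (newRow x r) _ s ⟩
      row ∷ insertAll (insertAll rs (fromMaybe (bumped x r))) bumpedWord
    ≡⟨ cong (row ∷_) (insertAll-++ rs (fromMaybe (bumped x r)) bumpedWord) ⟨
      row ∷ insertAll rs (fromMaybe (bumped x r) ++ bumpedWord)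
    ∎
    where
    open ≡-Reasoning
    row = proj₁ (insertRowAll (newRow x r) s)
    bumpedWord = proj₂ (insertRowAll (newRow x r) s)

  insertAll-knuthTriple : ∀ {s s'} T → All Sorted T → KnuthTriple s s' → insertAll T s ≡ insertAll T s'
  insertAll-reflKnuthTriple : ∀ {s s'} T → All Sorted T → ReflClosure KnuthTriple s s' →
                              insertAll T s ≡ insertAll T s'

  -- Inserting a nonempty word into [] or into [] ∷ [] computes the same tableau.
  insertAll-knuthTriple {x ∷ s} {x' ∷ s'} [] _ k =
    begin
      insertAll ([] ∷ []) (x ∷ s)
    ≡⟨ insertAll-∷ [] [] (x ∷ s) ⟩
      proj₁ (insertRowAll [] (x ∷ s)) ∷ insertAll [] (proj₂ (insertRowAll [] (x ∷ s)))
    ≡⟨ cong (λ p → proj₁ p ∷ insertAll [] (proj₂ p)) (insertRowAll-[]-triple k) ⟩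
      proj₁ (insertRowAll [] (x' ∷ s')) ∷ insertAll [] (proj₂ (insertRowAll [] (x' ∷ s')))
    ≡⟨ insertAll-∷ [] [] (x' ∷ s') ⟨
      insertAll ([] ∷ []) (x' ∷ s')
    ∎
    where open ≡-Reasoning
  insertAll-knuthTriple {s} {s'} (r ∷ rs) (sr ∷ srs) k =
    begin
      insertAll (r ∷ rs) s
    ≡⟨ insertAll-∷ r rs s ⟩
      proj₁ (insertRowAll r s) ∷ insertAll rs (proj₂ (insertRowAll r s))
    ≡⟨ cong₂ _∷_ sameRow (insertAll-reflKnuthTriple rs srs relatedBumped) ⟩
      proj₁ (insertRowAll r s') ∷ insertAll rs (proj₂ (insertRowAll r s'))
    ≡⟨ insertAll-∷ r rs s' ⟨
      insertAll (r ∷ rs) s'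
    ∎
    where
    open ≡-Reasoning
    sameRow = proj₁ (knuthTriple-row r sr k)
    relatedBumped = proj₂ (knuthTriple-row r sr k)

  insertAll-reflKnuthTriple T _ Refl.refl = refl
  insertAll-reflKnuthTriple T sT [ k ] = insertAll-knuthTriple T sT k

  insert-sorted : ∀ x T → All Sorted T → All Sorted (insert x T)
  insert-sorted x [] _ = ([] ∷ []) ∷ []
  insert-sorted x (r ∷ rs) (sr ∷ srs) with insertRow x r | newRow-sorted x r sr
  ... | nothing , _ | sr' = sr' ∷ srs
  ... | just y , _ | sr' = sr' ∷ insert-sorted y rs srs

  insertAll-sorted : ∀ T s → All Sorted T → All Sorted (insertAll T s)
  insertAll-sorted T [] sT = sT
  insertAll-sorted T (x ∷ s) sT = insertAll-sorted (insert x T) s (insert-sorted x T sT)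

  -- Colour classes

  index : B → Fin n
  index = Inverse.to fin

  _≟ᶜ_ : (c b : B) → Dec (index c ≡ index b)
  c ≟ᶜ b = FinP._≟_ (index c) (index b)

  index-injective : ∀ {c c'} → index c ≡ index c' → c ≡ c'
  index-injective = Injection.injective (↔⇒↣ fin)

  restrict-∷-≡ : ∀ b a c w → index c ≡ index b → restrict b ((a , c) ∷ w) ≡ a ∷ restrict b w
  restrict-∷-≡ b a c w c≡b with c ≟ᶜ b
  ... | yes _ = refl
  ... | no c≢b = ⊥-elim (c≢b c≡b)

  restrict-∷-≢ : ∀ b a c w → ¬ index c ≡ index b → restrict b ((a , c) ∷ w) ≡ restrict b w
  restrict-∷-≢ b a c w c≢b with c ≟ᶜ b
  ... | yes c≡b = ⊥-elim (c≢b c≡b)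
  ... | no _ = refl

  restrict-++ : ∀ b u v → restrict b (u ++ v) ≡ restrict b u ++ restrict b v
  restrict-++ b [] v = refl
  restrict-++ b ((a , c) ∷ u) v with c ≟ᶜ b
  ... | yes _ = cong (a ∷_) (restrict-++ b u v)
  ... | no _ = restrict-++ b u v

  monochrome : B → List A → Word
  monochrome β s = map (_, β) s

  restrict-monochrome-≡ : ∀ b β s → index β ≡ index b → restrict b (monochrome β s) ≡ s
  restrict-monochrome-≡ b β [] _ = refl
  restrict-monochrome-≡ b β (a ∷ s) β≡b =
    trans (restrict-∷-≡ b a β _ β≡b) (cong (a ∷_) (restrict-monochrome-≡ b β s β≡b))

  restrict-monochrome-≢ : ∀ b β s → ¬ index β ≡ index b → restrict b (monochrome β s) ≡ []
  restrict-monochrome-≢ b β [] _ = refl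
  restrict-monochrome-≢ b β (a ∷ s) β≢b =
    trans (restrict-∷-≢ b a β _ β≢b) (restrict-monochrome-≢ b β s β≢b)

  restrict-swap : ∀ b x y v → ¬ proj₂ x ≡ proj₂ y → restrict b (x ∷ y ∷ v) ≡ restrict b (y ∷ x ∷ v)
  restrict-swap b (a₁ , c₁) (a₂ , c₂) v c₁≢c₂ = cases (c₁ ≟ᶜ b) (c₂ ≟ᶜ b)
    where
    cases : Dec (index c₁ ≡ index b) → Dec (index c₂ ≡ index b) →
            restrict b ((a₁ , c₁) ∷ (a₂ , c₂) ∷ v) ≡ restrict b ((a₂ , c₂) ∷ (a₁ , c₁) ∷ v)
    cases (yes c₁≡b) (yes c₂≡b) = ⊥-elim (c₁≢c₂ (index-injective (trans c₁≡b (sym c₂≡b))))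
    cases (yes c₁≡b) (no c₂≢b)
      rewrite restrict-∷-≡ b a₁ c₁ ((a₂ , c₂) ∷ v) c₁≡b | restrict-∷-≢ b a₂ c₂ v c₂≢b
            | restrict-∷-≢ b a₂ c₂ ((a₁ , c₁) ∷ v) c₂≢b | restrict-∷-≡ b a₁ c₁ v c₁≡b = refl
    cases (no c₁≢b) (yes c₂≡b)
      rewrite restrict-∷-≢ b a₁ c₁ ((a₂ , c₂) ∷ v) c₁≢b | restrict-∷-≡ b a₂ c₂ v c₂≡b
            | restrict-∷-≡ b a₂ c₂ ((a₁ , c₁) ∷ v) c₂≡b | restrict-∷-≢ b a₁ c₁ v c₁≢b = refl
    cases (no c₁≢b) (no c₂≢b)
      rewrite restrict-∷-≢ b a₁ c₁ ((a₂ , c₂) ∷ v) c₁≢b | restrict-∷-≢ b a₂ c₂ v c₂≢b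
            | restrict-∷-≢ b a₂ c₂ ((a₁ , c₁) ∷ v) c₂≢b | restrict-∷-≢ b a₁ c₁ v c₁≢b = refl

  RS-++ : ∀ u s v → RS (u ++ s ++ v) ≡ insertAll (insertAll (RS u) s) v
  RS-++ u s v = trans (insertAll-++ [] u (s ++ v)) (insertAll-++ (RS u) s v)

  RSO-P-knuthTriple : ∀ u v β {s s'} → KnuthTriple s s' →
                      ∀ b → RSO-P (u ++ monochrome β s ++ v) b ≡ RSO-P (u ++ monochrome β s' ++ v) b
  RSO-P-knuthTriple u v β {s} {s'} k b
    rewrite restrict-++ b u (monochrome β s ++ v) | restrict-++ b u (monochrome β s' ++ v)
          | restrict-++ b (monochrome β s) v | restrict-++ b (monochrome β s') v
    with β ≟ᶜ b
  ... | yes β≡b rewrite restrict-monochrome-≡ b β s β≡b | restrict-monochrome-≡ b β s' β≡b =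
    begin
      RS (restrict b u ++ s ++ restrict b v)
    ≡⟨ RS-++ (restrict b u) s (restrict b v) ⟩
      insertAll (insertAll (RS (restrict b u)) s) (restrict b v)
    ≡⟨ cong (λ T → insertAll T (restrict b v))
            (insertAll-knuthTriple (RS (restrict b u)) (insertAll-sorted [] (restrict b u) []) k) ⟩
      insertAll (insertAll (RS (restrict b u)) s') (restrict b v)
    ≡⟨ RS-++ (restrict b u) s' (restrict b v) ⟨
      RS (restrict b u ++ s' ++ restrict b v)
    ∎
    where open ≡-Reasoning
  ... | no β≢b rewrite restrict-monochrome-≢ b β s β≢b | restrict-monochrome-≢ b β s' β≢b = refl

  RSO-P-knuthStep : ∀ {w w'} → KnuthStep w w' → ∀ b → RSO-P w b ≡ RSO-P w' b
  RSO-P-knuthStep (swapC u v x y c≢c') b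
    rewrite restrict-++ b u (x ∷ y ∷ v) | restrict-++ b u (y ∷ x ∷ v)
    = cong (λ l → RS (restrict b u ++ l)) (restrict-swap b x y v c≢c')
  RSO-P-knuthStep (acb→cab u v β a b c p q) = RSO-P-knuthTriple u v β (acb→cab p q)
  RSO-P-knuthStep (cab→acb u v β a b c p q) = RSO-P-knuthTriple u v β (cab→acb p q)
  RSO-P-knuthStep (bac→bca u v β a b c p q) = RSO-P-knuthTriple u v β (bac→bca p q)
  RSO-P-knuthStep (bca→bac u v β a b c p q) = RSO-P-knuthTriple u v β (bca→bac p q)

  knuthEquiv⇒sameRSO-P : ∀ {w w'} → KnuthEquiv w w' → ∀ b → RSO-P w b ≡ RSO-P w' b
  knuthEquiv⇒sameRSO-P ε b = refl
  knuthEquiv⇒sameRSO-P (step ◅ steps) b = trans (RSO-P-knuthStep step b) (knuthEquiv⇒sameRSO-P steps b)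

  knuthStep-∷⁺ : ∀ x {w w'} → KnuthStep w w' → KnuthStep (x ∷ w) (x ∷ w')
  knuthStep-∷⁺ x (swapC u v y z c≢c') = swapC (x ∷ u) v y z c≢c'
  knuthStep-∷⁺ x (acb→cab u v β a b c p q) = acb→cab (x ∷ u) v β a b c p q
  knuthStep-∷⁺ x (cab→acb u v β a b c p q) = cab→acb (x ∷ u) v β a b c p q
  knuthStep-∷⁺ x (bac→bca u v β a b c p q) = bac→bca (x ∷ u) v β a b c p q
  knuthStep-∷⁺ x (bca→bac u v β a b c p q) = bca→bac (x ∷ u) v β a b c p q

  knuthStep-++⁺ˡ : ∀ p {w w'} → KnuthStep w w' → KnuthStep (p ++ w) (p ++ w')
  knuthStep-++⁺ˡ [] step = step
  knuthStep-++⁺ˡ (x ∷ p) step = knuthStep-∷⁺ x (knuthStep-++⁺ˡ p step)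

  knuthStep-++⁺ʳ : ∀ q {w w'} → KnuthStep w w' → KnuthStep (w ++ q) (w' ++ q)
  knuthStep-++⁺ʳ q (swapC u v x y c≢c')
    rewrite ++-assoc u (x ∷ y ∷ v) q | ++-assoc u (y ∷ x ∷ v) q
    = swapC u (v ++ q) x y c≢c'
  knuthStep-++⁺ʳ q (acb→cab u v β a b c p r)
    rewrite ++-assoc u ((a , β) ∷ (c , β) ∷ (b , β) ∷ v) q
          | ++-assoc u ((c , β) ∷ (a , β) ∷ (b , β) ∷ v) q
    = acb→cab u (v ++ q) β a b c p r
  knuthStep-++⁺ʳ q (cab→acb u v β a b c p r)
    rewrite ++-assoc u ((c , β) ∷ (a , β) ∷ (b , β) ∷ v) q
          | ++-assoc u ((a , β) ∷ (c , β) ∷ (b , β) ∷ v) q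
    = cab→acb u (v ++ q) β a b c p r
  knuthStep-++⁺ʳ q (bac→bca u v β a b c p r)
    rewrite ++-assoc u ((b , β) ∷ (a , β) ∷ (c , β) ∷ v) q
          | ++-assoc u ((b , β) ∷ (c , β) ∷ (a , β) ∷ v) q
    = bac→bca u (v ++ q) β a b c p r
  knuthStep-++⁺ʳ q (bca→bac u v β a b c p r)
    rewrite ++-assoc u ((b , β) ∷ (c , β) ∷ (a , β) ∷ v) q
          | ++-assoc u ((b , β) ∷ (a , β) ∷ (c , β) ∷ v) q
    = bca→bac u (v ++ q) β a b c p r

  knuthStep-sym : ∀ {w w'} → KnuthStep w w' → KnuthStep w' w
  knuthStep-sym (swapC u v x y c≢c') = swapC u v y x (λ e → c≢c' (sym e))
  knuthStep-sym (acb→cab u v β a b c p q) = cab→acb u v β a b c p q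
  knuthStep-sym (cab→acb u v β a b c p q) = acb→cab u v β a b c p q
  knuthStep-sym (bac→bca u v β a b c p q) = bca→bac u v β a b c p q
  knuthStep-sym (bca→bac u v β a b c p q) = bac→bca u v β a b c p q

  knuth-∷⁺ : ∀ x {w w'} → KnuthEquiv w w' → KnuthEquiv (x ∷ w) (x ∷ w')
  knuth-∷⁺ x = gmap (x ∷_) (knuthStep-∷⁺ x)

  knuth-++⁺ˡ : ∀ p {w w'} → KnuthEquiv w w' → KnuthEquiv (p ++ w) (p ++ w')
  knuth-++⁺ˡ p = gmap (p ++_) (knuthStep-++⁺ˡ p)

  knuth-++⁺ʳ : ∀ q {w w'} → KnuthEquiv w w' → KnuthEquiv (w ++ q) (w' ++ q)
  knuth-++⁺ʳ q = gmap (_++ q) (knuthStep-++⁺ʳ q)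

  knuth-sym : ∀ {w w'} → KnuthEquiv w w' → KnuthEquiv w' w
  knuth-sym = reverse knuthStep-sym

  -- Reading words

  module Monochrome (β : B) where

    infix 4 _∼_
    _∼_ : List A → List A → Set
    u ∼ u' = KnuthEquiv (monochrome β u) (monochrome β u')

    ∼-++⁺ˡ : ∀ p {u u'} → u ∼ u' → p ++ u ∼ p ++ u'
    ∼-++⁺ˡ p {u} {u'} rewrite map-++ (_, β) p u | map-++ (_, β) p u' = knuth-++⁺ˡ (monochrome β p)

    ∼-++⁺ʳ : ∀ q {u u'} → u ∼ u' → u ++ q ∼ u' ++ q
    ∼-++⁺ʳ q {u} {u'} rewrite map-++ (_, β) u q | map-++ (_, β) u' q = knuth-++⁺ʳ (monochrome β q)

    row-∷ʳ-smaller : ∀ h t x → All (h ≤_) t → Sorted t → x < h → h ∷ t ++ x ∷ [] ∼ h ∷ x ∷ t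
    row-∷ʳ-smaller h [] x _ _ _ = ε
    row-∷ʳ-smaller h (t₁ ∷ t) x (h≤t₁ ∷ _) (t₁≤t ∷ st) x<h =
      knuth-∷⁺ (h , β) (row-∷ʳ-smaller t₁ t x t₁≤t st (<-≤-trans x<h h≤t₁))
      ◅◅ bca→bac [] (monochrome β t) β x h t₁ x<h h≤t₁ ◅ ε

    RowInsertionReading : A → List A → Maybe A × List A → Set
    RowInsertionReading x r (nothing , r') = r ++ x ∷ [] ≡ r'
    RowInsertionReading x r (just y , r') = r ++ x ∷ [] ∼ y ∷ r'

    Head : (A → Set) → List A → Set
    Head P [] = ⊥
    Head P (c ∷ _) = P c

    head-newRow-≤ : ∀ x r → Head (_≤ x) (newRow x r)
    head-newRow-≤ x [] = ≤-refl
    head-newRow-≤ x (h ∷ t) with x <? h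
    ... | yes _ = ≤-refl
    ... | no x≮h = ≮⇒≥ x≮h

    reading-past-head : ∀ h x t (m : Maybe A) t' → RowInsertionReading x t (m , t') → Maybe.All (x <_) m →
                        All (h ≤_) t' → Head (_≤ x) t' → RowInsertionReading x (h ∷ t) (m , h ∷ t')
    reading-past-head h x t nothing t' t∷ʳx≡t' _ _ _ = cong (h ∷_) t∷ʳx≡t'
    reading-past-head h x t (just y) (c ∷ t') t∷ʳx∼yct' (Maybe.just x<y) (h≤c ∷ _) c≤x =
      knuth-∷⁺ (h , β) t∷ʳx∼yct'
      ◅◅ acb→cab [] (monochrome β t') β h c y h≤c (≤-<-trans c≤x x<y) ◅ ε

    insertRow-reading : ∀ x r → Sorted r → RowInsertionReading x r (insertRow x r)
    insertRow-reading x [] _ = refl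
    insertRow-reading x (h ∷ t) (h≤t ∷ st) = cases (x <? h)
      where
      cases : Dec (x < h) → RowInsertionReading x (h ∷ t) (insertRow x (h ∷ t))
      cases (yes x<h) rewrite insertRow-< t x<h = row-∷ʳ-smaller h t x h≤t st x<h
      cases (no x≮h) rewrite insertRow-≮ t x≮h =
        reading-past-head h x t (bumped x t) (newRow x t) (insertRow-reading x t st)
          (bumped-> x t) (newRow-All (h ≤_) t h≤t (≮⇒≥ x≮h)) (head-newRow-≤ x t)

    reading : Tableau → List A
    reading [] = []
    reading (r ∷ rs) = reading rs ++ r

    reading-insert : ∀ x T → All Sorted T → reading T ++ x ∷ [] ∼ reading (insert x T)
    reading-insert x [] _ = ε
    reading-insert x (r ∷ rs) (sr ∷ srs) rewrite insert-∷ x r rs =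
      byBumped (bumped x r) (newRow x r) (insertRow-reading x r sr)
      where
      byBumped : ∀ m r' → RowInsertionReading x r (m , r') →
           (reading rs ++ r) ++ x ∷ [] ∼ reading (insertAll rs (fromMaybe m)) ++ r'
      byBumped nothing r' r∷ʳx≡r' rewrite ++-assoc (reading rs) r (x ∷ []) | r∷ʳx≡r' = ε
      byBumped (just y) r' r∷ʳx∼yr' rewrite ++-assoc (reading rs) r (x ∷ []) =
        ∼-++⁺ˡ (reading rs) r∷ʳx∼yr'
        ◅◅ subst (_∼ reading (insert y rs) ++ r') (++-assoc (reading rs) (y ∷ []) r')
             (∼-++⁺ʳ r' (reading-insert y rs srs))

    reading-insertAll : ∀ T u → All Sorted T → reading T ++ u ∼ reading (insertAll T u)
    reading-insertAll T [] _ rewrite ++-identityʳ (reading T) = ε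
    reading-insertAll T (x ∷ u) sT =
      subst (_∼ reading (insertAll T (x ∷ u))) (++-assoc (reading T) (x ∷ []) u)
        (∼-++⁺ʳ u (reading-insert x T sT) ◅◅ reading-insertAll (insert x T) u (insert-sorted x T sT))

    sameRS⇒∼ : ∀ u u' → RS u ≡ RS u' → u ∼ u'
    sameRS⇒∼ u u' RSu≡RSu' =
      reading-insertAll [] u []
      ◅◅ subst (λ T → reading T ∼ u') (sym RSu≡RSu') (knuth-sym (reading-insertAll [] u' []))

  -- Sorting a word by colour

  removeColour : B → Word → Word
  removeColour b [] = []
  removeColour b ((a , c) ∷ w) with c ≟ᶜ b
  ... | yes _ = removeColour b w
  ... | no _ = (a , c) ∷ removeColour b w

  removeColour-∷-≡ : ∀ b a c w → index c ≡ index b → removeColour b ((a , c) ∷ w) ≡ removeColour b w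
  removeColour-∷-≡ b a c w c≡b with c ≟ᶜ b
  ... | yes _ = refl
  ... | no c≢b = ⊥-elim (c≢b c≡b)

  removeColour-∷-≢ : ∀ b a c w → ¬ index c ≡ index b →
                     removeColour b ((a , c) ∷ w) ≡ (a , c) ∷ removeColour b w
  removeColour-∷-≢ b a c w c≢b with c ≟ᶜ b
  ... | yes c≡b = ⊥-elim (c≢b c≡b)
  ... | no _ = refl

  restrict-removeColour-≡ : ∀ b' b w → index b' ≡ index b → restrict b' (removeColour b w) ≡ []
  restrict-removeColour-≡ b' b [] _ = refl
  restrict-removeColour-≡ b' b ((a , c) ∷ w) b'≡b = cases (c ≟ᶜ b)
    where
    cases : Dec (index c ≡ index b) → restrict b' (removeColour b ((a , c) ∷ w)) ≡ []
    cases (yes c≡b) rewrite removeColour-∷-≡ b a c w c≡b = restrict-removeColour-≡ b' b w b'≡b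
    cases (no c≢b) rewrite removeColour-∷-≢ b a c w c≢b =
      trans (restrict-∷-≢ b' a c (removeColour b w) (λ c≡b' → c≢b (trans c≡b' b'≡b)))
            (restrict-removeColour-≡ b' b w b'≡b)

  restrict-removeColour-≢ : ∀ b' b w → ¬ index b' ≡ index b →
                            restrict b' (removeColour b w) ≡ restrict b' w
  restrict-removeColour-≢ b' b [] _ = refl
  restrict-removeColour-≢ b' b ((a , c) ∷ w) b'≢b =
    cases (c ≟ᶜ b) (c ≟ᶜ b')
    where
    cases : Dec (index c ≡ index b) → Dec (index c ≡ index b') →
            restrict b' (removeColour b ((a , c) ∷ w)) ≡ restrict b' ((a , c) ∷ w)
    cases (yes c≡b) (yes c≡b') = ⊥-elim (b'≢b (trans (sym c≡b') c≡b))
    cases (yes c≡b) (no c≢b') rewrite removeColour-∷-≡ b a c w c≡b | restrict-∷-≢ b' a c w c≢b' =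
      restrict-removeColour-≢ b' b w b'≢b
    cases (no c≢b) (yes c≡b')
      rewrite removeColour-∷-≢ b a c w c≢b | restrict-∷-≡ b' a c (removeColour b w) c≡b'
            | restrict-∷-≡ b' a c w c≡b' = cong (a ∷_) (restrict-removeColour-≢ b' b w b'≢b)
    cases (no c≢b) (no c≢b')
      rewrite removeColour-∷-≢ b a c w c≢b | restrict-∷-≢ b' a c (removeColour b w) c≢b'
            | restrict-∷-≢ b' a c w c≢b' = restrict-removeColour-≢ b' b w b'≢b

  knuth-swap-monochrome : ∀ x b s v → ¬ proj₂ x ≡ b →
                          KnuthEquiv (x ∷ monochrome b s ++ v) (monochrome b s ++ x ∷ v)
  knuth-swap-monochrome x b [] v _ = ε
  knuth-swap-monochrome x b (a ∷ s) v x≢b =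
    swapC [] (monochrome b s ++ v) x (a , b) x≢b ◅ knuth-∷⁺ (a , b) (knuth-swap-monochrome x b s v x≢b)

  knuth-extractColour : ∀ b w → KnuthEquiv w (monochrome b (restrict b w) ++ removeColour b w)
  knuth-extractColour b [] = ε
  knuth-extractColour b ((a , c) ∷ w) = cases (c ≟ᶜ b)
    where
    cases : Dec (index c ≡ index b) →
            KnuthEquiv ((a , c) ∷ w) (monochrome b (restrict b ((a , c) ∷ w)) ++ removeColour b ((a , c) ∷ w))
    cases (yes c≡b)
      rewrite restrict-∷-≡ b a c w c≡b | removeColour-∷-≡ b a c w c≡b | index-injective c≡b =
      knuth-∷⁺ (a , b) (knuth-extractColour b w)
    cases (no c≢b) rewrite restrict-∷-≢ b a c w c≢b | removeColour-∷-≢ b a c w c≢b =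
      knuth-∷⁺ (a , c) (knuth-extractColour b w)
      ◅◅ knuth-swap-monochrome (a , c) b (restrict b w) (removeColour b w) (λ c≡b → c≢b (cong index c≡b))

  ColoursIn : List B → Word → Set
  ColoursIn L w = All (λ x → proj₂ x ∈ L) w

  removeColour-ColoursIn : ∀ b L w → ColoursIn (b ∷ L) w → ColoursIn L (removeColour b w)
  removeColour-ColoursIn b L [] _ = []
  removeColour-ColoursIn b L ((a , c) ∷ w) (c∈bL ∷ w∈bL) = cases (c ≟ᶜ b)
    where
    cases : Dec (index c ≡ index b) → ColoursIn L (removeColour b ((a , c) ∷ w))
    cases (yes c≡b) rewrite removeColour-∷-≡ b a c w c≡b = removeColour-ColoursIn b L w w∈bL
    cases (no c≢b) rewrite removeColour-∷-≢ b a c w c≢b = c∈L c∈bL ∷ removeColour-ColoursIn b L w w∈bL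
      where
      c∈L : c ∈ b ∷ L → c ∈ L
      c∈L (here c≡b) = ⊥-elim (c≢b (cong index c≡b))
      c∈L (there c∈L) = c∈L

  sortByColour : List B → Word → Word
  sortByColour [] w = []
  sortByColour (b ∷ L) w = monochrome b (restrict b w) ++ sortByColour L (removeColour b w)

  knuth-sortByColour : ∀ L w → ColoursIn L w → KnuthEquiv w (sortByColour L w)
  knuth-sortByColour [] [] _ = ε
  knuth-sortByColour [] (_ ∷ _) (() ∷ _)
  knuth-sortByColour (b ∷ L) w w∈bL =
    knuth-extractColour b w
    ◅◅ knuth-++⁺ˡ (monochrome b (restrict b w))
         (knuth-sortByColour L (removeColour b w) (removeColour-ColoursIn b L w w∈bL))

  sortByColour-sameRS : ∀ L w w' → (∀ b → RSO-P w b ≡ RSO-P w' b) →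
                        KnuthEquiv (sortByColour L w) (sortByColour L w')
  sortByColour-sameRS [] w w' _ = ε
  sortByColour-sameRS (b ∷ L) w w' sameP =
    knuth-++⁺ʳ (sortByColour L (removeColour b w)) (Monochrome.sameRS⇒∼ b _ _ (sameP b))
    ◅◅ knuth-++⁺ˡ (monochrome b (restrict b w')) (sortByColour-sameRS L _ _ sameP-removeColour)
    where
    sameP-removeColour : ∀ b' → RSO-P (removeColour b w) b' ≡ RSO-P (removeColour b w') b'
    sameP-removeColour b' with b' ≟ᶜ b
    ... | yes b'≡b
      rewrite restrict-removeColour-≡ b' b w b'≡b | restrict-removeColour-≡ b' b w' b'≡b = refl
    ... | no b'≢b
      rewrite restrict-removeColour-≢ b' b w b'≢b | restrict-removeColour-≢ b' b w' b'≢b = sameP b'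

  colours : List B
  colours = map (Inverse.from fin) (allFin n)

  ∈-colours : ∀ c → c ∈ colours
  ∈-colours c =
    subst (_∈ colours) (Inverse.strictlyInverseʳ fin c) (∈-map⁺ (Inverse.from fin) (∈-allFin (index c)))

  ColoursIn-colours : ∀ w → ColoursIn colours w
  ColoursIn-colours = All.universal (λ x → ∈-colours (proj₂ x))

  sameRSO-P⇒knuthEquiv : ∀ w w' → (∀ b → RSO-P w b ≡ RSO-P w' b) → KnuthEquiv w w'
  sameRSO-P⇒knuthEquiv w w' sameP =
    knuth-sortByColour colours w (ColoursIn-colours w)
    ◅◅ sortByColour-sameRS colours w w' sameP
    ◅◅ knuth-sym (knuth-sortByColour colours w' (ColoursIn-colours w'))

proposition5p3 : (A : Set) (_<_ : Rel A 0ℓ) (sto : IsStrictTotalOrder _≡_ _<_)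
    (B : Set) (n : ℕ) (fin : B ↔ Fin n) (w w′ : RSO.Word A _<_ sto B n fin) →
    ((∀ b → RSO.RSO-P A _<_ sto B n fin w b ≡ RSO.RSO-P A _<_ sto B n fin w′ b)
      → RSO.KnuthEquiv A _<_ sto B n fin w w′)
    × (RSO.KnuthEquiv A _<_ sto B n fin w w′
      → (∀ b → RSO.RSO-P A _<_ sto B n fin w b ≡ RSO.RSO-P A _<_ sto B n fin w′ b))
proposition5p3 A _<_ sto B n fin w w′ =
  RSOKnuth.sameRSO-P⇒knuthEquiv A _<_ sto B n fin w w′ , RSOKnuth.knuthEquiv⇒sameRSO-P A _<_ sto B n fin
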